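{- For $2\le B\le 10$, the Gaussian $B$-happy numbers of height $3$ of smallest absolute value are exactly the numbers $z,-z,\pm\overline{z},\pm iz,\pm i\overline{z}$, where $z=1+i$ for $B=2$; $z=7+10i$ for $B=3$; $z=1+i$ for $B=4$; $z=4+15i$ for $B=5$; $z=11+17i$ for $B=6$; $z=20+27i$ for $B=7$; $z=2+2i$ for $B=8$; $z=2+9i$ for $B=9$; $z=12+12i$ for $B=10$ (all written in ordinary decimal notation).
   Context: Fix an integer $B\ge 2$. Every nonzero Gaussian integer $a+bi$ is written uniquely as $a+bi=\sum_{j=0}^n (a_j+b_ji)B^j$ with $a_j,b_j\in\mathbb{Z}$, $a_n,b_n$ not both $0$, and for each $j$: $|a_j|\le B-1$, $|b_j|\le B-1$, $\operatorname{sgn}(a)a_j\ge 0$, $\operatorname{sgn}(b)b_j\ge 0$. The Gaussian $B$-happy function $S_B:\mathbb{Z}[i]\to\mathbb{Z}[i]$ is defined by $S_B(0)=0$ and $S_B(a+bi)=\sum_{j=0}^n (a_j+b_ji)^2$. A Gaussian integer $z$ is Gaussian $B$-happy if $S_B^k(z)=1$ for some $k\ge1$. The height of a Gaussian $B$-happy number $z$ is the least $k\in\mathbb{Z}_{\ge0}$ with $S_B^k(z)=1$ ($S_B^0$ is the identity). "Smallest" means of minimal complex absolute value. -}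

module Defs where

open import Data.Nat as ℕ using (ℕ; zero; suc; _<_)
open import Data.Nat.DivMod using (_/_; _%_)
open import Data.Integer as ℤ using (ℤ; +_; -_; ∣_∣; _+_; _-_; _*_)
open import Data.Product using (_×_; _,_; proj₁; proj₂)
open import Data.List using (List; []; _∷_; map; foldr)
open import Relation.Binary.PropositionalEquality using (_≡_; _≢_)

ℤ[i] : Set
ℤ[i] = ℤ × ℤ

re im : ℤ[i] → ℤ
re = proj₁
im = proj₂

_+ᴳ_ : ℤ[i] → ℤ[i] → ℤ[i]
(a , b) +ᴳ (c , d) = (a + c , b + d)

_*ᴳ_ : ℤ[i] → ℤ[i] → ℤ[i]
(a , b) *ᴳ (c , d) = (a * c - b * d , a * d + b * c)

0ᴳ 1ᴳ : ℤ[i]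
0ᴳ = (+ 0 , + 0)
1ᴳ = (+ 1 , + 0)

normSq : ℤ[i] → ℤ
normSq (a , b) = a * a + b * b

-- Base-B digits of a natural number n, least significant first, without
-- leading zeros (the digit list of 0 is empty).  The fuel argument is
-- at least the number of digits needed (n itself suffices for B ≥ 2).
digitsFuel : ℕ → ℕ → ℕ → List ℕ
digitsFuel zero    B n = []
digitsFuel (suc f) zero n = []
digitsFuel (suc f) (suc B') zero = []
digitsFuel (suc f) (suc B') (suc m) =
  (suc m % suc B') ∷ digitsFuel f (suc B') (suc m / suc B')

digitsℕ : ℕ → ℕ → List ℕ
digitsℕ B n = digitsFuel n B n

sgn : ℤ → ℤ
sgn (+ zero)   = + 0
sgn (+ suc _)  = + 1
sgn ℤ.-[1+ _ ] = - (+ 1)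

digitsℤ : ℕ → ℤ → List ℤ
digitsℤ B a = map (λ d → sgn a * + d) (digitsℕ B ∣ a ∣)

zipPad : List ℤ → List ℤ → List ℤ[i]
zipPad []       []       = []
zipPad []       (y ∷ ys) = (+ 0 , y) ∷ zipPad [] ys
zipPad (x ∷ xs) []       = (x , + 0) ∷ zipPad xs []
zipPad (x ∷ xs) (y ∷ ys) = (x , y) ∷ zipPad xs ys

gaussDigits : ℕ → ℤ[i] → List ℤ[i]
gaussDigits B (a , b) = zipPad (digitsℤ B a) (digitsℤ B b)

-- The Gaussian B-happy function S_B(a + b i) = Σ_j (a_j + b_j i)^2
-- (S_B(0) = 0 since the digit list of 0 is empty).
S : ℕ → ℤ[i] → ℤ[i]
S B z = foldr (λ d acc → (d *ᴳ d) +ᴳ acc) 0ᴳ (gaussDigits B z)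

iterS : ℕ → ℕ → ℤ[i] → ℤ[i]
iterS B zero    z = z
iterS B (suc k) z = S B (iterS B k z)

HasHeight : ℕ → ℕ → ℤ[i] → Set
HasHeight B k z = (iterS B k z ≡ 1ᴳ) × (∀ j → j < k → iterS B j z ≢ 1ᴳ)

SmallestHeight3 : ℕ → ℤ[i] → Set
SmallestHeight3 B z = HasHeight B 3 z × (∀ w → HasHeight B 3 w → normSq z ℤ.≤ normSq w)

orbit : ℤ[i] → List ℤ[i]
orbit (x , y) =
  (x , y) ∷ (- x , - y) ∷ (x , - y) ∷ (- x , y) ∷
  (- y , x) ∷ (y , - x) ∷ (y , x) ∷ (- y , - x) ∷ []

-- the base point z for each base B (2 ≤ B ≤ 10); value outside that range irrelevant
zB : ℕ → ℤ[i]
zB 2  = (+ 1  , + 1)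
zB 3  = (+ 7  , + 10)
zB 4  = (+ 1  , + 1)
zB 5  = (+ 4  , + 15)
zB 6  = (+ 11 , + 17)
zB 7  = (+ 20 , + 27)
zB 8  = (+ 2  , + 2)
zB 9  = (+ 2  , + 9)
zB 10 = (+ 12 , + 12)
zB _  = 0ᴳ

-- Having height 3 is decidable, since it only involves S_B, S_B² and S_B³.
-- If every point of the orbit has squared norm n and height 3, then the
-- orbit is exactly the set of smallest height-3 numbers as soon as no other
-- Gaussian integer of squared norm at most n has height 3.  Such integers lie
-- in the box |a|, |b| ≤ r whenever n < (r + 1)², so for each B the claim is a
-- finite check carried out by evaluating a decision procedure.
module Submission where

open import Defs
open import Data.Nat using (ℕ; _≤_)
open import Data.List.Membership.Propositional using (_∈_)
open import Function.Bundles using (_⇔_; mk⇔)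

open import Data.Nat as ℕ using (zero; suc; s≤s; _<_; _<?_)
import Data.Nat.Properties as ℕ
open import Data.Integer as ℤ using (ℤ; +_; -_; ∣_∣; -[1+_])
import Data.Integer.Properties as ℤ
open import Data.Product using (_×_; _,_; proj₁; proj₂)
open import Data.Sum using (inj₁; inj₂)
open import Data.Product.Properties using (≡-dec)
open import Data.List.Relation.Unary.All as All using (All)
open import Data.List.Relation.Unary.Any using (here)
import Data.List.Membership.DecPropositional as DecMembership
open import Relation.Nullary using (Dec; yes; no; contradiction)
open import Relation.Nullary.Decidable
  using (True; toWitness; map′; ¬?; _×-dec_; _→-dec_)
open import Relation.Unary using (Pred; Decidable)
open import Relation.Binary.PropositionalEquality
  using (_≡_; _≢_; refl; sym; trans; subst; cong₂)

_≟ᴳ_ : (z w : ℤ[i]) → Dec (z ≡ w)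
_≟ᴳ_ = ≡-dec ℤ._≟_ ℤ._≟_

open DecMembership _≟ᴳ_ using (_∈?_)

hasHeight? : ∀ B k z → Dec (HasHeight B k z)
hasHeight? B k z =
  (iterS B k z ≟ᴳ 1ᴳ) ×-dec
  map′ (λ h j → h {j}) (λ h {j} → h j)
       (ℕ.allUpTo? {P = λ j → iterS B j z ≢ 1ᴳ} (λ j → ¬? (iterS B j z ≟ᴳ 1ᴳ)) k)

allAbsUpTo? : ∀ {p} {P : Pred ℤ p} → Decidable P →
              ∀ r → Dec (∀ a → ∣ a ∣ ≤ r → P a)
allAbsUpTo? {P = P} P? r =
  map′ fromPairs toPairs (ℕ.allUpTo? (λ m → P? (+ m) ×-dec P? (- + m)) (suc r))
  where
  fromPairs : (∀ {m} → m < suc r → P (+ m) × P (- + m)) →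
              ∀ a → ∣ a ∣ ≤ r → P a
  fromPairs h (+ m)     m≤r = proj₁ (h (s≤s m≤r))
  fromPairs h -[1+ m ]  m<r = proj₂ (h (s≤s m<r))

  toPairs : (∀ a → ∣ a ∣ ≤ r → P a) →
            ∀ {m} → m < suc r → P (+ m) × P (- + m)
  toPairs h {zero}  (s≤s m≤r) = h (+ 0) m≤r , h (+ 0) m≤r
  toPairs h {suc m} (s≤s m≤r) = h (+ suc m) m≤r , h -[1+ m ] m≤r

i*i≡+∣i∣*∣i∣ : ∀ i → i ℤ.* i ≡ + (∣ i ∣ ℕ.* ∣ i ∣)
i*i≡+∣i∣*∣i∣ (+ m)     = ℤ.+◃n≡+n (m ℕ.* m)
i*i≡+∣i∣*∣i∣ -[1+ _ ]  = refl

normSq≡+∣re∣²+∣im∣² : ∀ a b →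
  normSq (a , b) ≡ + (∣ a ∣ ℕ.* ∣ a ∣ ℕ.+ ∣ b ∣ ℕ.* ∣ b ∣)
normSq≡+∣re∣²+∣im∣² a b = cong₂ ℤ._+_ (i*i≡+∣i∣*∣i∣ a) (i*i≡+∣i∣*∣i∣ b)

m*m<[1+r]*[1+r]⇒m≤r : ∀ {m r} → m ℕ.* m < suc r ℕ.* suc r → m ≤ r
m*m<[1+r]*[1+r]⇒m≤r {m} {r} m²<[1+r]² with m ℕ.≤? r
... | yes m≤r = m≤r
... | no  m≰r = contradiction (ℕ.*-mono-≤ r<m r<m) (ℕ.<⇒≱ m²<[1+r]²)
  where
  r<m : r < m
  r<m = ℕ.≰⇒> m≰r

normSq≤⇒∣re∣≤∧∣im∣≤ : ∀ {a b n r} → normSq (a , b) ℤ.≤ + n →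
  n < suc r ℕ.* suc r → ∣ a ∣ ≤ r × ∣ b ∣ ≤ r
normSq≤⇒∣re∣≤∧∣im∣≤ {a} {b} {n} {r} normSq≤n n<[1+r]²
  with subst (ℤ._≤ + n) (normSq≡+∣re∣²+∣im∣² a b) normSq≤n
... | ℤ.+≤+ a²+b²≤n =
  m*m<[1+r]*[1+r]⇒m≤r (ℕ.≤-<-trans (ℕ.≤-trans (ℕ.m≤m+n _ _) a²+b²≤n) n<[1+r]²) ,
  m*m<[1+r]*[1+r]⇒m≤r (ℕ.≤-<-trans (ℕ.≤-trans (ℕ.m≤n+m _ _) a²+b²≤n) n<[1+r]²)

∈-orbit-self : ∀ z → z ∈ orbit z
∈-orbit-self (x , y) = here refl

smallestHeight3⇔∈orbit : ∀ B z n →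
  All (λ v → HasHeight B 3 v × normSq v ≡ + n) (orbit z) →
  (∀ w → normSq w ℤ.≤ + n → HasHeight B 3 w → w ∈ orbit z) →
  ∀ w → SmallestHeight3 B w ⇔ w ∈ orbit z
smallestHeight3⇔∈orbit B z n orbitHeight3 onlyOrbit w = mk⇔ to from
  where
  to : SmallestHeight3 B w → w ∈ orbit z
  to (height3 , minimal) =
    let height3-z , normSq-z = All.lookup orbitHeight3 (∈-orbit-self z)
    in onlyOrbit w (subst (normSq w ℤ.≤_) normSq-z (minimal z height3-z)) height3

  from : w ∈ orbit z → SmallestHeight3 B w
  from w∈orbit = height3 , minimal
    where
    height3 : HasHeight B 3 w
    height3 = proj₁ (All.lookup orbitHeight3 w∈orbit)

    normSq-w : normSq w ≡ + n
    normSq-w = proj₂ (All.lookup orbitHeight3 w∈orbit)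

    minimal : ∀ v → HasHeight B 3 v → normSq w ℤ.≤ normSq v
    minimal v height3-v with ℤ.≤-total (normSq v) (+ n)
    ... | inj₁ v≤n = ℤ.≤-reflexive (trans normSq-w
          (sym (proj₂ (All.lookup orbitHeight3 (onlyOrbit v v≤n height3-v)))))
    ... | inj₂ n≤v = subst (ℤ._≤ normSq v) (sym normSq-w) n≤v

normSq≤-search : ∀ {p} {P : Pred ℤ[i] p} {n r} → n < suc r ℕ.* suc r →
  (∀ a → ∣ a ∣ ≤ r → ∀ b → ∣ b ∣ ≤ r → normSq (a , b) ℤ.≤ + n → P (a , b)) →
  ∀ w → normSq w ℤ.≤ + n → P w
normSq≤-search n<[1+r]² inBox (a , b) normSq≤n =
  let ∣a∣≤r , ∣b∣≤r = normSq≤⇒∣re∣≤∧∣im∣≤ {a} {b} normSq≤n n<[1+r]²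
  in inBox a ∣a∣≤r b ∣b∣≤r normSq≤n

smallestHeight3-by-search : ∀ B z n r →
  {True (n <? suc r ℕ.* suc r)} →
  {True (All.all? (λ v → hasHeight? B 3 v ×-dec normSq v ℤ.≟ + n) (orbit z))} →
  {True (allAbsUpTo? (λ a → allAbsUpTo? (λ b →
           normSq (a , b) ℤ.≤? + n →-dec hasHeight? B 3 (a , b) →-dec (a , b) ∈? orbit z) r) r)} →
  ∀ w → SmallestHeight3 B w ⇔ w ∈ orbit z
smallestHeight3-by-search B z n r {n<[1+r]²} {orbitHeight3} {boxCheck} =
  smallestHeight3⇔∈orbit B z n (toWitness orbitHeight3)
    (normSq≤-search (toWitness n<[1+r]²) (toWitness boxCheck))

theorem9 : (B : ℕ) → 2 ≤ B → B ≤ 10 → (w : ℤ[i]) →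
    SmallestHeight3 B w ⇔ w ∈ orbit (zB B)
-- The third argument is n = |z_B|², the fourth r = ⌊√n⌋.
theorem9 0  ()        _
theorem9 1  (s≤s ()) _
theorem9 2  _ _ = smallestHeight3-by-search 2  (zB 2)  2    1
theorem9 3  _ _ = smallestHeight3-by-search 3  (zB 3)  149  12
theorem9 4  _ _ = smallestHeight3-by-search 4  (zB 4)  2    1
theorem9 5  _ _ = smallestHeight3-by-search 5  (zB 5)  241  15
theorem9 6  _ _ = smallestHeight3-by-search 6  (zB 6)  410  20
theorem9 7  _ _ = smallestHeight3-by-search 7  (zB 7)  1129 33
theorem9 8  _ _ = smallestHeight3-by-search 8  (zB 8)  8    2
theorem9 9  _ _ = smallestHeight3-by-search 9  (zB 9)  85   9
theorem9 10 _ _ = smallestHeight3-by-search 10 (zB 10) 288  16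
theorem9 (suc (suc (suc (suc (suc (suc (suc (suc (suc (suc (suc _))))))))))) _
  (s≤s (s≤s (s≤s (s≤s (s≤s (s≤s (s≤s (s≤s (s≤s (s≤s ()))))))))))
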